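{- Let $G$ and $H$ be graphs. Then $\chi_d(G\circ H) = n(G) + \chi(H)$, where $n(G)$ is the number of vertices of $G$ and $\chi(H)$ is the chromatic number of $H$.
   Context: Graphs are finite and simple. A dominator coloring of a graph $X$ is a proper vertex coloring of $X$ such that every vertex $u$ either forms a color class by itself (its color class is $\{u\}$) or is adjacent to all vertices of at least one color class. The dominator chromatic number $\chi_d(X)$ is the minimum number of colors in a dominator coloring of $X$. The corona product $G\circ H$ is obtained from one copy of $G$ and $n(G)$ disjoint copies of $H$ by joining with an edge each vertex of the $i$-th copy of $H$ to the $i$-th vertex of $G$, for $i=1,\dots,n(G)$. -}

module Defs where

open import Data.Nat using (ℕ; _+_; _*_; _≤_)
open import Data.Fin using (Fin; splitAt; remQuot; _≟_)
open import Data.Bool using (Bool; true; false; _∧_)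
open import Data.Sum using (_⊎_; inj₁; inj₂)
open import Data.Product using (Σ; _×_; _,_; ∃)
open import Relation.Binary.PropositionalEquality using (_≡_; _≢_)
open import Relation.Nullary.Decidable using (⌊_⌋)

record Graph : Set where
  field
    n   : ℕ
    adj : Fin n → Fin n → Bool
open Graph public

IsSimple : Graph → Set
IsSimple X = (∀ u v → adj X u v ≡ adj X v u) × (∀ u → adj X u u ≡ false)

Coloring : Graph → ℕ → Set
Coloring X k = Fin (n X) → Fin k

IsProper : (X : Graph) {k : ℕ} → Coloring X k → Set
IsProper X c = ∀ u v → adj X u v ≡ true → c u ≢ c v

Dominates : (X : Graph) {k : ℕ} → Coloring X k → Fin (n X) → Fin k → Set
Dominates X c u i = (∃ λ w → c w ≡ i) × (∀ w → c w ≡ i → adj X u w ≡ true)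

IsDominatorColoring : (X : Graph) {k : ℕ} → Coloring X k → Set
IsDominatorColoring X {k} c =
  IsProper X c ×
  (∀ u → (∀ v → c v ≡ c u → v ≡ u) ⊎ (Σ (Fin k) λ i → Dominates X c u i))

IsChromaticNumber : Graph → ℕ → Set
IsChromaticNumber X m =
  (Σ (Coloring X m) λ c → IsProper X c) ×
  (∀ k → (c : Coloring X k) → IsProper X c → m ≤ k)

IsDominatorChromaticNumber : Graph → ℕ → Set
IsDominatorChromaticNumber X m =
  (Σ (Coloring X m) λ c → IsDominatorColoring X c) ×
  (∀ k → (c : Coloring X k) → IsDominatorColoring X c → m ≤ k)

-- Corona product G ∘ H. Vertex set Fin (n G + n G * n H):
-- splitAt gives inj₁ i (the i-th vertex of G) or inj₂ p, where
-- remQuot p = (i , v) is vertex v of the i-th copy of H.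
coronaAdj : (G H : Graph) → Fin (n G) ⊎ (Fin (n G) × Fin (n H))
          → Fin (n G) ⊎ (Fin (n G) × Fin (n H)) → Bool
coronaAdj G H (inj₁ i) (inj₁ j) = adj G i j
coronaAdj G H (inj₁ i) (inj₂ (j , v)) = ⌊ i ≟ j ⌋
coronaAdj G H (inj₂ (i , u)) (inj₁ j) = ⌊ i ≟ j ⌋
coronaAdj G H (inj₂ (i , u)) (inj₂ (j , v)) = ⌊ i ≟ j ⌋ ∧ adj H u v

decode : (G H : Graph) → Fin (n G + n G * n H) → Fin (n G) ⊎ (Fin (n G) × Fin (n H))
decode G H x with splitAt (n G) x
... | inj₁ i = inj₁ i
... | inj₂ p = inj₂ (remQuot (n H) p)

corona : Graph → Graph → Graph
corona G H = record
  { n   = n G + n G * n H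
  ; adj = λ x y → coronaAdj G H (decode G H x) (decode G H y)
  }

module Submission where

-- A vertex of G forms a colour class on its own in the colouring that gives the n(G) vertices
-- of G distinct colours and colours every copy of H by one optimal colouring of H with further
-- colours; each copy vertex then dominates the singleton class of its hub.  Conversely, fix a vertex g₀
-- of G. For every other vertex i of G, the dominator condition at a vertex of the i-th copy of H
-- yields a colour class inside the closed neighbourhood of that vertex, hence inside the i-th
-- copy together with i. These n(G) - 1 colours, together with the colour of g₀, are pairwise
-- distinct and absent from the g₀-th copy of H, which needs χ(H) further colours.

open import Defs
open import Data.Nat using (ℕ; zero; suc; _+_; _*_; _≤_)
open import Data.Nat.Properties using (+-monoʳ-≤)
open import Data.Fin using (Fin; splitAt; combine; join; fromℕ<; _↑ˡ_; _↑ʳ_; punchOut; _≟_)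
  renaming (zero to 0F; suc to 1+)
open import Data.Fin.Properties
  using (splitAt-↑ˡ; splitAt-↑ʳ; splitAt-join; remQuot-combine; combine-remQuot;
         splitAt⁻¹-↑ˡ; splitAt⁻¹-↑ʳ; punchOut-injective; suc-injective)
open import Data.Bool using (true; _∧_)
open import Data.Sum using (_⊎_; inj₁; inj₂)
open import Data.Sum.Properties using (inj₁-injective; inj₂-injective)
open import Data.Product using (Σ; Σ-syntax; ∃; _×_; _,_; proj₁; proj₂)
open import Data.Empty using (⊥-elim)
open import Function using (_∘_; id)
open import Function.Definitions using (Injective)
open import Relation.Binary.PropositionalEquality
open import Relation.Nullary using (Dec; yes; no; contradiction)
open import Relation.Nullary.Decidable using (⌊_⌋; isYes≗does; dec-true)

isYes⇒ : ∀ {A : Set} (a? : Dec A) → ⌊ a? ⌋ ≡ true → A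
isYes⇒ (yes a) _ = a

isYes-≟-refl : ∀ {m} (i : Fin m) → ⌊ i ≟ i ⌋ ≡ true
isYes-≟-refl i = trans (isYes≗does (i ≟ i)) (dec-true (i ≟ i) refl)

∧-trueˡ : ∀ {a b} → a ∧ b ≡ true → a ≡ true
∧-trueˡ {true} _ = refl

∧-trueʳ : ∀ {a b} → a ∧ b ≡ true → b ≡ true
∧-trueʳ {true} e = e

join-injective : ∀ m n {x y : Fin m ⊎ Fin n} → join m n x ≡ join m n y → x ≡ y
join-injective m n {x} {y} e =
  trans (sym (splitAt-join m n x)) (trans (cong (splitAt m) e) (splitAt-join m n y))

↑ˡ≢↑ʳ : ∀ {m n} (i : Fin m) (j : Fin n) → i ↑ˡ n ≢ m ↑ʳ j
↑ˡ≢↑ʳ {m} {n} i j e with join-injective m n {inj₁ i} {inj₂ j} e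
... | ()

removeColours : ∀ {A : Set} {K} m (r : Fin m → Fin K) → Injective _≡_ _≡_ r →
                (d : A → Fin K) → (∀ a j → d a ≢ r j) →
                Σ[ K′ ∈ ℕ ] m + K′ ≡ K × Σ[ d′ ∈ (A → Fin K′) ] (∀ a b → d′ a ≡ d′ b → d a ≡ d b)
removeColours zero r _ d _ = _ , refl , d , λ _ _ → id
removeColours {K = zero} (suc m) r _ _ _ with r 0F
... | ()
removeColours {A} {suc K} (suc m) r r-inj d d-avoids =
  let K′ , m+K′≡K , d′ , d′-reflects = removeColours m r₊ r₊-inj d₀ d₀-avoids
  in  K′ , cong suc m+K′≡K , d′ , λ a b → d₀-reflects ∘ d′-reflects a b
  where
  r₀≢d : ∀ a → r 0F ≢ d a
  r₀≢d a = d-avoids a 0F ∘ sym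

  r₀≢r₊ : ∀ j → r 0F ≢ r (1+ j)
  r₀≢r₊ j e with r-inj e
  ... | ()

  d₀ : A → Fin K
  d₀ a = punchOut (r₀≢d a)

  r₊ : Fin m → Fin K
  r₊ j = punchOut (r₀≢r₊ j)

  d₀-reflects : ∀ {a b} → d₀ a ≡ d₀ b → d a ≡ d b
  d₀-reflects = punchOut-injective (r₀≢d _) (r₀≢d _)

  r₊-inj : Injective _≡_ _≡_ r₊
  r₊-inj e = suc-injective (r-inj (punchOut-injective (r₀≢r₊ _) (r₀≢r₊ _) e))

  d₀-avoids : ∀ a j → d₀ a ≢ r₊ j
  d₀-avoids a j = d-avoids a (1+ j) ∘ punchOut-injective (r₀≢d a) (r₀≢r₊ j)

IsProper-reflect : (X : Graph) {k l : ℕ} (c : Coloring X k) (c′ : Coloring X l) →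
                   IsProper X c → (∀ u v → c′ u ≡ c′ v → c u ≡ c v) → IsProper X c′
IsProper-reflect X c c′ c-proper reflects u v uv = c-proper u v uv ∘ reflects u v

avoided+χ≤colours : (X : Graph) (χ : ℕ) → (∀ K (c : Coloring X K) → IsProper X c → χ ≤ K) →
                          ∀ {K} m (c : Coloring X K) → IsProper X c →
                          (r : Fin m → Fin K) → Injective _≡_ _≡_ r → (∀ u j → c u ≢ r j) →
                          m + χ ≤ K
avoided+χ≤colours X χ χ-min m c c-proper r r-inj c-avoids
  with K′ , refl , c′ , c′-reflects ← removeColours m r r-inj c c-avoids =
  +-monoʳ-≤ m (χ-min K′ c′ (IsProper-reflect X c c′ c-proper c′-reflects))

dominatorColoring-class-⊆-closedNeighbourhood :
  (X : Graph) {k : ℕ} (c : Coloring X k) → IsDominatorColoring X c → ∀ x →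
  Σ[ i ∈ Fin k ] (∃ λ y → c y ≡ i) × (∀ y → c y ≡ i → y ≡ x ⊎ adj X x y ≡ true)
dominatorColoring-class-⊆-closedNeighbourhood X c (_ , dominating) x with dominating x
... | inj₁ singleton                = c x , (x , refl) , λ y cy≡cx → inj₁ (singleton y cy≡cx)
... | inj₂ (i , nonempty , adjacent) = i , nonempty , λ y cy≡i → inj₂ (adjacent y cy≡i)

module Corona (G H : Graph) where

  X : Graph
  X = corona G H

  V : Set
  V = Fin (n G) ⊎ (Fin (n G) × Fin (n H))

  encode : V → Fin (n X)
  encode (inj₁ i)       = i ↑ˡ (n G * n H)
  encode (inj₂ (i , u)) = n G ↑ʳ combine i u

  hub : Fin (n G) → Fin (n X)
  hub i = encode (inj₁ i)

  copy : Fin (n G) → Fin (n H) → Fin (n X)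
  copy i u = encode (inj₂ (i , u))

  decode-encode : ∀ a → decode G H (encode a) ≡ a
  decode-encode (inj₁ i) rewrite splitAt-↑ˡ (n G) i (n G * n H) = refl
  decode-encode (inj₂ (i , u)) rewrite splitAt-↑ʳ (n G) (n G * n H) (combine i u)
                                     | remQuot-combine {n G} {n H} i u = refl

  encode-decode : ∀ x → encode (decode G H x) ≡ x
  encode-decode x with splitAt (n G) x in eq
  ... | inj₁ i = splitAt⁻¹-↑ˡ eq
  ... | inj₂ p = trans (cong (n G ↑ʳ_) (combine-remQuot {n G} (n H) p)) (splitAt⁻¹-↑ʳ eq)

  decode-injective : Injective _≡_ _≡_ (decode G H)
  decode-injective {x} {y} e = trans (sym (encode-decode x)) (trans (cong encode e) (encode-decode y))

  adj-copy : ∀ i u v → adj X (copy i u) (copy i v) ≡ adj H u v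
  adj-copy i u v rewrite decode-encode (inj₂ (i , u)) | decode-encode (inj₂ (i , v))
                       | isYes-≟-refl i = refl

  adj-copy-hub : ∀ i u → adj X (copy i u) (hub i) ≡ true
  adj-copy-hub i u rewrite decode-encode (inj₂ (i , u)) | decode-encode (inj₁ i) =
    isYes-≟-refl i

  region : V → Fin (n G)
  region (inj₁ i)       = i
  region (inj₂ (i , _)) = i

  regionOf : Fin (n X) → Fin (n G)
  regionOf = region ∘ decode G H

  regionOf-encode : ∀ a → regionOf (encode a) ≡ region a
  regionOf-encode a = cong region (decode-encode a)

  coronaAdj-region : ∀ i u b → coronaAdj G H (inj₂ (i , u)) b ≡ true → region b ≡ i
  coronaAdj-region i u (inj₁ j)       ij = sym (isYes⇒ (i ≟ j) ij)
  coronaAdj-region i u (inj₂ (j , v)) ij = sym (isYes⇒ (i ≟ j) (∧-trueˡ ij))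

  closedNeighbourhood-copy : ∀ i u y → y ≡ copy i u ⊎ adj X (copy i u) y ≡ true → regionOf y ≡ i
  closedNeighbourhood-copy i u y (inj₁ refl) = regionOf-encode (inj₂ (i , u))
  closedNeighbourhood-copy i u y (inj₂ adjacent) = coronaAdj-region i u (decode G H y)
    (subst (λ a → coronaAdj G H a (decode G H y) ≡ true) (decode-encode (inj₂ (i , u))) adjacent)

module UpperBound (G H : Graph) (G-simple : IsSimple G) {k : ℕ}
                  (cH : Coloring H k) (cH-proper : IsProper H cH) where
  open Corona G H

  colourV : V → Fin (n G + k)
  colourV (inj₁ i)       = i ↑ˡ k
  colourV (inj₂ (_ , u)) = n G ↑ʳ cH u

  colour : Coloring X (n G + k)
  colour = colourV ∘ decode G H

  colourV-hub : ∀ a i → colourV a ≡ i ↑ˡ k → a ≡ inj₁ i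
  colourV-hub (inj₁ j)       i e = cong inj₁ (inj₁-injective (join-injective (n G) k e))
  colourV-hub (inj₂ (_ , u)) i e = ⊥-elim (↑ˡ≢↑ʳ i (cH u) (sym e))

  colourV-proper : ∀ a b → coronaAdj G H a b ≡ true → colourV a ≢ colourV b
  colourV-proper (inj₁ i) (inj₁ j) ij e with colourV-hub (inj₁ i) j e
  ... | refl = contradiction (trans (sym ij) (proj₂ G-simple i)) λ ()
  colourV-proper (inj₁ i)       (inj₂ (j , v)) _  = ↑ˡ≢↑ʳ i (cH v)
  colourV-proper (inj₂ (i , u)) (inj₁ j)       _  = ↑ˡ≢↑ʳ j (cH u) ∘ sym
  colourV-proper (inj₂ (i , u)) (inj₂ (j , v)) uv e =
    cH-proper u v (∧-trueʳ uv) (inj₂-injective (join-injective (n G) k e))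

  colour-dominator : IsDominatorColoring X colour
  colour-dominator = (λ x y → colourV-proper (decode G H x) (decode G H y)) , dominating
    where
    dominating : ∀ x → (∀ y → colour y ≡ colour x → y ≡ x)
                       ⊎ Σ[ i ∈ Fin (n G + k) ] Dominates X colour x i
    dominating x with decode G H x in x≡
    ... | inj₁ i       = inj₁ λ y e → decode-injective (trans (colourV-hub (decode G H y) i e) (sym x≡))
    ... | inj₂ (i , u) = inj₂ (i ↑ˡ k , (hub i , cong colourV (decode-encode (inj₁ i))) , λ y e →
            subst (λ b → coronaAdj G H (inj₂ (i , u)) b ≡ true)
                  (sym (colourV-hub (decode G H y) i e)) (isYes-≟-refl i))

module LowerBound (G H : Graph) {χ : ℕ} (χ-min : ∀ K (c : Coloring H K) → IsProper H c → χ ≤ K)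
                  (g₀ : Fin (n G)) (u₀ : Fin (n H))
                  {K : ℕ} (c : Coloring (corona G H) K) (c-dominator : IsDominatorColoring (corona G H) c)
                  where
  open Corona G H

  c-proper : IsProper X c
  c-proper = proj₁ c-dominator

  ColourWithin : Fin (n G) → Fin K → Set
  ColourWithin i col = (∃ λ y → c y ≡ col) × (∀ y → c y ≡ col → regionOf y ≡ i)

  privateColour : ∀ i → Σ (Fin K) (ColourWithin i)
  privateColour i =
    let col , nonempty , ⊆N[x] = dominatorColoring-class-⊆-closedNeighbourhood X c c-dominator (copy i u₀)
    in  col , nonempty , λ y cy≡col → closedNeighbourhood-copy i u₀ y (⊆N[x] y cy≡col)

  -- The private colour of g₀ might occur on the g₀-th copy of H; the colour of the hub g₀ cannot.
  reserved : ∀ i → Dec (i ≡ g₀) → Fin K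
  reserved i (yes _) = c (hub g₀)
  reserved i (no _)  = proj₁ (privateColour i)

  reserved-meets : ∀ i i≟g₀ → ∃ λ y → c y ≡ reserved i i≟g₀ × regionOf y ≡ i
  reserved-meets i (yes refl) = hub i , refl , regionOf-encode (inj₁ i)
  reserved-meets i (no _) =
    let _ , (y , cy≡col) , ⊆region = privateColour i in y , cy≡col , ⊆region y cy≡col

  reserved-within : ∀ i i≟g₀ → i ≢ g₀ → ∀ y → c y ≡ reserved i i≟g₀ → regionOf y ≡ i
  reserved-within i (yes i≡g₀) i≢g₀ = contradiction i≡g₀ i≢g₀
  reserved-within i (no _)     _    = proj₂ (proj₂ (privateColour i))

  reservedColour : Fin (n G) → Fin K
  reservedColour i = reserved i (i ≟ g₀)

  reservedColour-injective : Injective _≡_ _≡_ reservedColour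
  reservedColour-injective {a} {b} ra≡rb with a ≟ g₀ | b ≟ g₀
  ... | yes refl | yes refl = refl
  ... | no a≢g₀  | b≟g₀ =
    let y , cy≡rb , y∈b = reserved-meets b b≟g₀
    in  trans (sym (reserved-within a (no a≢g₀) a≢g₀ y (trans cy≡rb (sym ra≡rb)))) y∈b
  ... | yes a≡g₀ | no b≢g₀ =
    let y , cy≡ra , y∈a = reserved-meets a (yes a≡g₀)
    in  trans (sym y∈a) (reserved-within b (no b≢g₀) b≢g₀ y (trans cy≡ra ra≡rb))

  c₀ : Coloring H K
  c₀ u = c (copy g₀ u)

  c₀-proper : IsProper H c₀
  c₀-proper u v uv = c-proper _ _ (trans (adj-copy g₀ u v) uv)

  c₀-avoids-reserved : ∀ u j → c₀ u ≢ reservedColour j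
  c₀-avoids-reserved u j with j ≟ g₀
  ... | yes refl = c-proper _ _ (adj-copy-hub j u)
  ... | no j≢g₀  = λ c₀u≡rj → j≢g₀ (trans (sym (reserved-within j (no j≢g₀) j≢g₀ (copy g₀ u) c₀u≡rj))
                                          (regionOf-encode (inj₂ (g₀ , u))))

  lowerBound : n G + χ ≤ K
  lowerBound =
    avoided+χ≤colours H χ χ-min (n G) c₀ c₀-proper reservedColour reservedColour-injective c₀-avoids-reserved

mainTheorem1 : (G H : Graph) → IsSimple G → IsSimple H →
               1 ≤ n G → 1 ≤ n H →
               (k : ℕ) → IsChromaticNumber H k →
               IsDominatorChromaticNumber (corona G H) (n G + k)
mainTheorem1 G H G-simple _ nG≥1 nH≥1 k ((cH , cH-proper) , χ-min) =
  (colour , colour-dominator) ,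
  λ K c c-dominator → LowerBound.lowerBound G H χ-min (fromℕ< nG≥1) (fromℕ< nH≥1) c c-dominator
  where open UpperBound G H G-simple cH cH-proper
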